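{- Let $m,n$ be positive integers with $m\mid n$, and let $b=n^2+1$. If $t\in\{1,m^2,n^2\}$, then there exist infinitely many $D(-1)$-quadruples of the form $\{1,b,-c,d\}$ with $c,d>0$ in the ring $\mathbb{Z}[\sqrt{ -t}]$.
   Context: For a positive integer $t$, $\mathbb{Z}[\sqrt{ -t}]=\{a+b\sqrt{ -t}: a,b\in\mathbb{Z}\}$. For a non-zero element $n$ of a commutative ring $R$, a $D(n)$-$m$-tuple is a set of $m$ non-zero elements of $R$ such that for any two distinct elements $a,b$ of the set, $ab+n=k^2$ for some $k\in R$. A $D(-1)$-quadruple is the case $n=-1$, $m=4$. The condition $c,d>0$ means $c,d$ are positive (rational) integers. -}

module Defs where

open import Data.Nat using (ℕ)
open import Data.Integer using (ℤ; +_; _+_; _-_; _*_; -_)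
open import Data.Product using (_×_; _,_; ∃)
open import Data.Fin using (Fin)
open import Relation.Binary.PropositionalEquality using (_≡_; _≢_)

-- Elements a + b√(-t) of ℤ[√-t] (t a positive integer), represented by the
-- coefficient pair (a , b); since √-t ∉ ℚ, this representation is unique,
-- so equality in the ring is equality of pairs.
Zt : Set
Zt = ℤ × ℤ

addT : Zt → Zt → Zt
addT (a , b) (c , d) = (a + c , b + d)

mulT : ℕ → Zt → Zt → Zt
mulT t (a , b) (c , d) = (a * c - (+ t) * (b * d) , a * d + b * c)

zeroT : Zt
zeroT = (+ 0 , + 0)

ι : ℤ → Zt
ι a = (a , + 0)

IsSquareT : ℕ → Zt → Set
IsSquareT t x = ∃ λ k → x ≡ mulT t k k

IsDTuple : (t : ℕ) (n : Zt) (m : ℕ) → (Fin m → Zt) → Set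
IsDTuple t n m v =
  ((i : Fin m) → v i ≢ zeroT) ×
  ((i j : Fin m) → i ≢ j → v i ≢ v j) ×
  ((i j : Fin m) → i ≢ j → IsSquareT t (addT (mulT t (v i) (v j)) n))

quad : ℤ → ℤ → ℤ → ℤ → Fin 4 → Zt
quad w x y z Fin.zero = ι w
quad w x y z (Fin.suc Fin.zero) = ι x
quad w x y z (Fin.suc (Fin.suc Fin.zero)) = ι y
quad w x y z (Fin.suc (Fin.suc (Fin.suc Fin.zero))) = ι z

minusOneT : Zt
minusOneT = ι (- (+ 1))

{-# OPTIONS --safe #-}
-- Let b = n² + 1 and let (v, u) run through the (unboundedly growing) solutions of the negative
-- Pell equation v² + 1 = b u².  With c = n²u² - 1 and d = n²(nu + v)² + 1, the products
-- 1·b - 1 = n², 1·d - 1 = (n(nu + v))² and b·d - 1 = (nbu + n²v)² are squares, while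
-- 1·(-c) - 1 = -(nu)², b·(-c) - 1 = -(nv)² and (-c)·d - 1 = -(n(c + nuv))² are minus squares of
-- multiples of n.  In each of the three cases t ∈ {1, m², n²} we have n² = t q² for some integer q
-- (using m ∣ n), so -(ns)² = (qs√-t)² is a square in ℤ[√-t].
module Submission where

open import Defs
open import Data.Nat using (ℕ; NonZero; >-nonZero⁻¹) renaming (_+_ to _+ℕ_; _*_ to _*ℕ_; _<_ to _<ℕ_)
open import Data.Nat.Divisibility using (_∣_; divides)
import Data.Nat.Properties as ℕ
open import Data.Product using (_×_; _,_; proj₁; proj₂; ∃; ∃₂)
open import Data.Sum using (_⊎_; inj₁; inj₂)
open import Relation.Binary.PropositionalEquality
  using (_≡_; _≢_; refl; sym; trans; cong; cong₂; subst; subst₂; ≢-sym; module ≡-Reasoning)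

module NegativePell where

  open import Data.Nat using (zero; suc; _+_; _*_; _<_; z≤n; s≤s)
  open import Data.Nat.Properties using (+-cancelʳ-≡; *-identityʳ; *-mono-<; m<m+n; m≤n+m; ≤-trans; ≤-<-trans)
  open import Data.Nat.Tactic.RingSolver using (solve-∀)
  open ≡-Reasoning

  IsSolution : ℕ → ℕ × ℕ → Set
  IsSolution n (v , u) = v * v + 1 ≡ (n * n + 1) * (u * u)

  -- Multiplication of v + u√(n²+1) by the unit (2n²+1) + 2n√(n²+1) of norm 1.
  step : ℕ → ℕ × ℕ → ℕ × ℕ
  step n (v , u) = v + 2 * n * (n * v + (n * n + 1) * u) , u + 2 * n * (v + n * u)

  step-isSolution : ∀ n p → IsSolution n p → IsSolution n (step n p)
  step-isSolution n (v , u) sol = +-cancelʳ-≡ (b * (u * u)) _ _ (begin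
    v′ * v′ + 1 + b * (u * u)    ≡⟨ norm-multiplicative n v u ⟩
    b * (u′ * u′) + (v * v + 1)  ≡⟨ cong (b * (u′ * u′) +_) sol ⟩
    b * (u′ * u′) + b * (u * u)  ∎)
    where
    b v′ u′ : ℕ
    b = n * n + 1
    v′ = proj₁ (step n (v , u))
    u′ = proj₂ (step n (v , u))
    norm-multiplicative : ∀ n v u →
      let b = n * n + 1 ; v′ = v + 2 * n * (n * v + b * u) ; u′ = u + 2 * n * (v + n * u) in
      v′ * v′ + 1 + b * (u * u) ≡ b * (u′ * u′) + (v * v + 1)
    norm-multiplicative = solve-∀

  solution : ℕ → ℕ → ℕ × ℕ
  solution n zero    = n , 1
  solution n (suc k) = step n (solution n k)

  solution-isSolution : ∀ n k → IsSolution n (solution n k)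
  solution-isSolution n zero    = sym (*-identityʳ (n * n + 1))
  solution-isSolution n (suc k) = step-isSolution n (solution n k) (solution-isSolution n k)

  step-increases-u : ∀ {n} v {u} → 0 < n → 0 < u → u < proj₂ (step n (v , u))
  step-increases-u {n} v {u} 0<n 0<u =
    m<m+n u (*-mono-< (*-mono-< (s≤s (z≤n {1})) 0<n) (≤-trans (*-mono-< 0<n 0<u) (m≤n+m (n * u) v)))

  solution-u-grows : ∀ {n} → 0 < n → ∀ k → k < proj₂ (solution n k)
  solution-u-grows 0<n zero    = s≤s z≤n
  solution-u-grows 0<n (suc k) =
    ≤-<-trans (solution-u-grows 0<n k) (step-increases-u _ 0<n (≤-trans (s≤s z≤n) (solution-u-grows 0<n k)))

module QuadrupleSize (n u v : ℕ) {{_ : NonZero n}} (1<u : 1 <ℕ u) where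

  open import Data.Nat using (_+_; _*_; _∸_; _<_; z≤n; s≤s; >-nonZero; >-nonZero⁻¹)
  open import Data.Nat.Properties
  open ≤-Reasoning

  ℓ A B C D : ℕ
  ℓ = n * u
  A = n * (ℓ + v)
  B = n * n + 1
  C = ℓ * ℓ ∸ 1
  D = A * A + 1

  1<ℓ : 1 < ℓ
  1<ℓ = <-≤-trans 1<u (m≤n*m u n)

  1<ℓ*ℓ : 1 < ℓ * ℓ
  1<ℓ*ℓ = *-mono-< 1<ℓ 1<ℓ

  0<C : 0 < C
  0<C = m<n⇒0<n∸m 1<ℓ*ℓ

  0<D : 0 < D
  0<D = m≤n+m 1 (A * A)

  1<B : 1 < B
  1<B = m<n+m 1 (*-mono-< (>-nonZero⁻¹ n) (>-nonZero⁻¹ n))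

  n<A : n < A
  n<A = subst (_< A) (*-identityʳ n) (*-monoʳ-< n (<-≤-trans 1<ℓ (m≤m+n ℓ v)))

  B<D : B < D
  B<D = +-monoˡ-< 1 (*-mono-< n<A n<A)

  N<C+D : ∀ {N} → N < u → N < C + D
  N<C+D {N} N<u = begin-strict
    N         <⟨ N<u ⟩
    u         ≤⟨ m≤n*m u n ⟩
    ℓ         ≤⟨ m≤m+n ℓ v ⟩
    ℓ + v     ≤⟨ m≤n*m (ℓ + v) n ⟩
    A         ≤⟨ m≤m*n A A {{>-nonZero (≤-<-trans z≤n n<A)}} ⟩
    A * A     <⟨ m<m+n (A * A) (s≤s z≤n) ⟩
    D         ≤⟨ m≤n+m D C ⟩
    C + D     ∎

n²≡t*q² : ∀ {m n t} → m ∣ n → (t ≡ 1 ⊎ t ≡ m *ℕ m ⊎ t ≡ n *ℕ n) → ∃ λ q → n *ℕ n ≡ t *ℕ (q *ℕ q)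
n²≡t*q² {n = n} _               (inj₁ refl)        = n , sym (ℕ.*-identityˡ (n *ℕ n))
n²≡t*q² {m} (divides k refl)    (inj₂ (inj₁ refl)) =
  k , trans (ℕ.[m*n]*[o*p]≡[m*o]*[n*p] k m k m) (ℕ.*-comm (k *ℕ k) (m *ℕ m))
n²≡t*q² {n = n} _               (inj₂ (inj₂ refl)) = 1 , sym (ℕ.*-identityʳ (n *ℕ n))

open import Data.Integer using (ℤ; +_; -_; _+_; _-_; _*_; _<_; +<+; _⊖_)
open import Data.Integer.Tactic.RingSolver using (solve-∀)
open import Data.List using (List; []; _∷_; length; lookup)
open import Data.List.Relation.Unary.All as All using (All; []; _∷_)
open import Data.List.Relation.Unary.AllPairs using (AllPairs; []; _∷_)
open import Data.List.Membership.Propositional.Properties using (∈-lookup)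
open import Data.Fin using (Fin; zero; suc)
open import Function using (_∘_)
open import Relation.Binary.Definitions using (Symmetric)
open import Relation.Nullary using (contradiction)
import Data.Integer.Properties as ℤ

ι-injective : ∀ {x y} → ι x ≡ ι y → x ≡ y
ι-injective = cong proj₁

ι*ι-1 : ∀ t x y → addT (mulT t (ι x) (ι y)) minusOneT ≡ ι (x * y - + 1)
ι*ι-1 t x y = cong₂ _,_ (real-part x y (+ t)) (imaginary-part x y)
  where
  real-part : ∀ x y s → x * y - s * (+ 0 * + 0) + - + 1 ≡ x * y - + 1
  real-part = solve-∀
  imaginary-part : ∀ x y → x * + 0 + + 0 * y + + 0 ≡ + 0
  imaginary-part = solve-∀

ι-square-isSquareT : ∀ t a → IsSquareT t (ι (a * a))
ι-square-isSquareT t a = (a , + 0) , cong₂ _,_ (real-part a (+ t)) (imaginary-part a)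
  where
  real-part : ∀ a s → a * a ≡ a * a - s * (+ 0 * + 0)
  real-part = solve-∀
  imaginary-part : ∀ a → + 0 ≡ a * + 0 + + 0 * a
  imaginary-part = solve-∀

ι-neg-t-square-isSquareT : ∀ t a → IsSquareT t (ι (- (+ t * (a * a))))
ι-neg-t-square-isSquareT t a = (+ 0 , a) , cong₂ _,_ (real-part a (+ t)) (imaginary-part a)
  where
  real-part : ∀ a s → - (s * (a * a)) ≡ + 0 * + 0 - s * (a * a)
  real-part = solve-∀
  imaginary-part : ∀ a → + 0 ≡ + 0 * a + a * + 0
  imaginary-part = solve-∀

record IsDMinusOnePair (t : ℕ) (x y : ℤ) : Set where
  constructor dMinusOnePair
  field isSquareT : IsSquareT t (ι (x * y - + 1))

IsDMinusOnePair-sym : ∀ {t} → Symmetric (IsDMinusOnePair t)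
IsDMinusOnePair-sym {t} {x} {y} (dMinusOnePair sq) =
  dMinusOnePair (subst (λ z → IsSquareT t (ι (z - + 1))) (ℤ.*-comm x y) sq)

AllPairs-lookup : ∀ {a r} {A : Set a} {R : A → A → Set r} → Symmetric R →
  ∀ {xs} → AllPairs R xs → ∀ i j → i ≢ j → R (lookup xs i) (lookup xs j)
AllPairs-lookup sym-R (_   ∷ _)   zero    zero    0≢0   = contradiction refl 0≢0
AllPairs-lookup sym-R (Rx  ∷ _)   zero    (suc j) _     = All.lookup Rx (∈-lookup j)
AllPairs-lookup sym-R (Rx  ∷ _)   (suc i) zero    _     = sym-R (All.lookup Rx (∈-lookup i))
AllPairs-lookup sym-R (_   ∷ Rxs) (suc i) (suc j) si≢sj = AllPairs-lookup sym-R Rxs i j (si≢sj ∘ cong suc)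

IsDTuple-resp : ∀ {t n m} {f g : Fin m → Zt} → (∀ i → f i ≡ g i) → IsDTuple t n m f → IsDTuple t n m g
IsDTuple-resp {t} {n} f≗g (nonzero , distinct , squares) =
  (λ i gi≡0 → nonzero i (trans (f≗g i) gi≡0)) ,
  (λ i j i≢j gi≡gj → distinct i j i≢j (trans (f≗g i) (trans gi≡gj (sym (f≗g j))))) ,
  (λ i j i≢j → subst₂ (λ x y → IsSquareT t (addT (mulT t x y) n)) (f≗g i) (f≗g j) (squares i j i≢j))

integers-isDTuple : ∀ t (xs : List ℤ) → All (_≢ + 0) xs → AllPairs _≢_ xs → AllPairs (IsDMinusOnePair t) xs →
  IsDTuple t minusOneT (length xs) (ι ∘ lookup xs)
integers-isDTuple t xs nonzero distinct pairs =
  (λ i → All.lookup nonzero (∈-lookup i) ∘ ι-injective) ,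
  (λ i j i≢j → AllPairs-lookup ≢-sym distinct i j i≢j ∘ ι-injective) ,
  (λ i j i≢j → subst (IsSquareT t) (sym (ι*ι-1 t (lookup xs i) (lookup xs j))) (IsDMinusOnePair.isSquareT (AllPairs-lookup IsDMinusOnePair-sym pairs i j i≢j)))

quad-isDTuple : ∀ t w x y z → let xs = w ∷ x ∷ y ∷ z ∷ [] in
  All (_≢ + 0) xs → AllPairs _≢_ xs → AllPairs (IsDMinusOnePair t) xs →
  IsDTuple t minusOneT 4 (quad w x y z)
quad-isDTuple t w x y z nonzero distinct pairs =
  IsDTuple-resp {t} lookup≗quad (integers-isDTuple t (w ∷ x ∷ y ∷ z ∷ []) nonzero distinct pairs)
  where
  lookup≗quad : ∀ i → ι (lookup (w ∷ x ∷ y ∷ z ∷ []) i) ≡ quad w x y z i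
  lookup≗quad zero                   = refl
  lookup≗quad (suc zero)             = refl
  lookup≗quad (suc (suc zero))       = refl
  lookup≗quad (suc (suc (suc zero))) = refl

module _ {b c d : ℤ} (0<c : + 0 < c) (1<b : + 1 < b) (b<d : b < d) where

  private
    >⇒≢ : ∀ {x y} → y < x → x ≢ y
    >⇒≢ = ≢-sym ∘ ℤ.<⇒≢
    0<1 : + 0 < + 1
    0<1 = +<+ (ℕ.n<1+n 0)
    -c<0 : - c < + 0
    -c<0 = ℤ.neg-mono-< 0<c
    0<b : + 0 < b
    0<b = ℤ.<-trans 0<1 1<b
    1<d : + 1 < d
    1<d = ℤ.<-trans 1<b b<d
    -c<1 : - c < + 1
    -c<1 = ℤ.<-trans -c<0 0<1
    -c<b : - c < b
    -c<b = ℤ.<-trans -c<1 1<b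
    -c<d : - c < d
    -c<d = ℤ.<-trans -c<b b<d

  signed-quadruple-nonzero : All (_≢ + 0) (+ 1 ∷ b ∷ - c ∷ d ∷ [])
  signed-quadruple-nonzero = >⇒≢ 0<1 ∷ >⇒≢ 0<b ∷ ℤ.<⇒≢ -c<0 ∷ >⇒≢ (ℤ.<-trans 0<1 1<d) ∷ []

  signed-quadruple-distinct : AllPairs _≢_ (+ 1 ∷ b ∷ - c ∷ d ∷ [])
  signed-quadruple-distinct =
    (ℤ.<⇒≢ 1<b ∷ >⇒≢ -c<1 ∷ ℤ.<⇒≢ 1<d ∷ []) ∷
    (>⇒≢ -c<b ∷ ℤ.<⇒≢ b<d ∷ []) ∷
    (ℤ.<⇒≢ -c<d ∷ []) ∷
    [] ∷ []

module DQuadruple (t : ℕ) (n u v q : ℤ)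
  (pell : v * v + + 1 ≡ (n * n + + 1) * (u * u)) (n²≡tq² : n * n ≡ + t * (q * q)) where

  b c a d e w : ℤ
  b = n * n + + 1
  c = n * u * (n * u) - + 1
  a = n * (n * u + v)
  d = a * a + + 1
  e = n * b * u + n * n * v
  w = c + n * u * v

  private
    modulo-pell : ∀ {x y} → x ≡ y + n * n * (v * v + + 1 - b * (u * u)) → x ≡ y
    modulo-pell {x} {y} x≡y+δ = begin
      x                                        ≡⟨ x≡y+δ ⟩
      y + n * n * (v * v + + 1 - b * (u * u))  ≡⟨ cong (λ z → y + n * n * (z - b * (u * u))) pell ⟩
      y + n * n * (b * (u * u) - b * (u * u))  ≡⟨ cong (λ z → y + n * n * z) (ℤ.+-inverseʳ (b * (u * u))) ⟩
      y + n * n * + 0                          ≡⟨ cong (λ z → y + z) (ℤ.*-zeroʳ (n * n)) ⟩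
      y + + 0                                  ≡⟨ ℤ.+-identityʳ y ⟩
      y                                        ∎
      where open ≡-Reasoning

    pair-by-square : ∀ {x y} s → x * y - + 1 ≡ s * s → IsDMinusOnePair t x y
    pair-by-square s eq = dMinusOnePair (subst (IsSquareT t ∘ ι) (sym eq) (ι-square-isSquareT t s))

    -- Here n² = t q² makes -(ns)² = -t (qs)² the square of qs√-t.
    pair-by-neg-square : ∀ {x y} s → x * y - + 1 ≡ - (n * s * (n * s)) → IsDMinusOnePair t x y
    pair-by-neg-square s eq = dMinusOnePair (subst (IsSquareT t ∘ ι) (sym (trans eq (cong -_ n²s²≡tq²s²)))
      (ι-neg-t-square-isSquareT t (q * s)))
      where
      n²s²≡tq²s² : n * s * (n * s) ≡ + t * (q * s * (q * s))
      n²s²≡tq²s² = begin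
        n * s * (n * s)            ≡⟨ [xy][xy]≡[xx][yy] n s ⟩
        n * n * (s * s)            ≡⟨ cong (_* (s * s)) n²≡tq² ⟩
        + t * (q * q) * (s * s)    ≡⟨ ℤ.*-assoc (+ t) (q * q) (s * s) ⟩
        + t * (q * q * (s * s))    ≡⟨ cong (+ t *_) (sym ([xy][xy]≡[xx][yy] q s)) ⟩
        + t * (q * s * (q * s))    ∎
        where
        open ≡-Reasoning
        [xy][xy]≡[xx][yy] : ∀ x y → x * y * (x * y) ≡ x * x * (y * y)
        [xy][xy]≡[xx][yy] = solve-∀

    1*[s+1]-1≡s : ∀ s → + 1 * (s + + 1) - + 1 ≡ s
    1*[s+1]-1≡s = solve-∀

    1*-[s-1]-1≡-s : ∀ s → + 1 * - (s - + 1) - + 1 ≡ - s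
    1*-[s-1]-1≡-s = solve-∀

    b*-c-1 : ∀ n u v →
      let b = n * n + + 1
          c = n * u * (n * u) - + 1
      in b * - c - + 1 ≡ - (n * v * (n * v)) + n * n * (v * v + + 1 - b * (u * u))
    b*-c-1 = solve-∀

    b*d-1 : ∀ n u v →
      let b = n * n + + 1
          d = n * (n * u + v) * (n * (n * u + v)) + + 1
          e = n * b * u + n * n * v
      in b * d - + 1 ≡ e * e + n * n * (v * v + + 1 - b * (u * u))
    b*d-1 = solve-∀

    -c*d-1 : ∀ n u v →
      let b = n * n + + 1
          c = n * u * (n * u) - + 1
          d = n * (n * u + v) * (n * (n * u + v)) + + 1
          w = c + n * u * v
      in - c * d - + 1 ≡ - (n * w * (n * w)) + n * n * (v * v + + 1 - b * (u * u))
    -c*d-1 = solve-∀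

  pairs : AllPairs (IsDMinusOnePair t) (+ 1 ∷ b ∷ - c ∷ d ∷ [])
  pairs =
    (pair-by-square n (1*[s+1]-1≡s (n * n)) ∷
     pair-by-neg-square u (1*-[s-1]-1≡-s (n * u * (n * u))) ∷
     pair-by-square a (1*[s+1]-1≡s (a * a)) ∷ []) ∷
    (pair-by-neg-square v (modulo-pell (b*-c-1 n u v)) ∷
     pair-by-square e (modulo-pell (b*d-1 n u v)) ∷ []) ∷
    (pair-by-neg-square w (modulo-pell (-c*d-1 n u v)) ∷ []) ∷
    [] ∷ []

module PellQuadruple (t n q : ℕ) {{_ : NonZero n}} (n²≡tq² : n *ℕ n ≡ t *ℕ (q *ℕ q))
  (v u : ℕ) (pell : NegativePell.IsSolution n (v , u)) (1<u : 1 <ℕ u) where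

  open QuadrupleSize n u v 1<u public using (C; D; 0<C; 0<D; N<C+D)
  open QuadrupleSize n u v 1<u using (ℓ; A; B; 1<ℓ*ℓ; 1<B; B<D)
  open ≡-Reasoning

  private
    pos-square : ∀ {x y} → + x ≡ y → + (x *ℕ x) ≡ y * y
    pos-square {x} refl = ℤ.pos-* x x

    +B≡b : + B ≡ + n * + n + + 1
    +B≡b = cong (_+ + 1) (ℤ.pos-* n n)

    pell-ℤ : + v * + v + + 1 ≡ (+ n * + n + + 1) * (+ u * + u)
    pell-ℤ = begin
      + v * + v + + 1                  ≡⟨ cong (_+ + 1) (sym (ℤ.pos-* v v)) ⟩
      + (v *ℕ v) + + 1                 ≡⟨ cong +_ pell ⟩
      + (B *ℕ (u *ℕ u))                ≡⟨ ℤ.pos-* B (u *ℕ u) ⟩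
      + B * + (u *ℕ u)                 ≡⟨ cong₂ _*_ +B≡b (ℤ.pos-* u u) ⟩
      (+ n * + n + + 1) * (+ u * + u)  ∎

    n²≡tq²-ℤ : + n * + n ≡ + t * (+ q * + q)
    n²≡tq²-ℤ = begin
      + n * + n            ≡⟨ sym (ℤ.pos-* n n) ⟩
      + (n *ℕ n)           ≡⟨ cong +_ n²≡tq² ⟩
      + (t *ℕ (q *ℕ q))    ≡⟨ ℤ.pos-* t (q *ℕ q) ⟩
      + t * + (q *ℕ q)     ≡⟨ cong (+ t *_) (ℤ.pos-* q q) ⟩
      + t * (+ q * + q)    ∎

  open DQuadruple t (+ n) (+ u) (+ v) (+ q) pell-ℤ n²≡tq²-ℤ using (b; c; d; pairs)

  private
    +C≡c : + C ≡ c
    +C≡c = begin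
      + C                      ≡⟨ sym (ℤ.⊖-≥ (ℕ.<⇒≤ 1<ℓ*ℓ)) ⟩
      ℓ *ℕ ℓ ⊖ 1               ≡⟨ sym (ℤ.m-n≡m⊖n (ℓ *ℕ ℓ) 1) ⟩
      + (ℓ *ℕ ℓ) - + 1         ≡⟨ cong (_- + 1) (pos-square (ℤ.pos-* n u)) ⟩
      c                        ∎

    +A≡a : + A ≡ + n * (+ n * + u + + v)
    +A≡a = trans (ℤ.pos-* n _) (cong (λ z → + n * (z + + v)) (ℤ.pos-* n u))

    +D≡d : + D ≡ d
    +D≡d = cong (_+ + 1) (pos-square +A≡a)

    0<c : + 0 < + C
    0<c = +<+ 0<C

    1<b : + 1 < b
    1<b = subst (+ 1 <_) +B≡b (+<+ 1<B)

    b<d : b < + D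
    b<d = subst (_< + D) +B≡b (+<+ B<D)

  nonzero : All (_≢ + 0) (+ 1 ∷ b ∷ - + C ∷ + D ∷ [])
  nonzero = signed-quadruple-nonzero 0<c 1<b b<d

  distinct : AllPairs _≢_ (+ 1 ∷ b ∷ - + C ∷ + D ∷ [])
  distinct = signed-quadruple-distinct 0<c 1<b b<d

  dMinusOnePairs : AllPairs (IsDMinusOnePair t) (+ 1 ∷ b ∷ - + C ∷ + D ∷ [])
  dMinusOnePairs = subst₂ (λ c d → AllPairs (IsDMinusOnePair t) (+ 1 ∷ b ∷ - c ∷ d ∷ [])) (sym +C≡c) (sym +D≡d) pairs

proposition2 : (m n : ℕ) → NonZero m → NonZero n → m ∣ n → (t : ℕ) →
    (t ≡ 1 ⊎ t ≡ m *ℕ m ⊎ t ≡ n *ℕ n) →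
    (N : ℕ) → ∃₂ λ (c d : ℤ) → + 0 < c × + 0 < d × + N < c + d ×
      IsDTuple t minusOneT 4 (quad (+ 1) (+ n * + n + + 1) (- c) d)
proposition2 m n _ n≢0 m∣n t t-cases N =
  + C , + D , +<+ 0<C , +<+ 0<D , +<+ (N<C+D (ℕ.<-trans (ℕ.n<1+n N) N+1<u)) ,
  quad-isDTuple t _ _ _ _ nonzero distinct dMinusOnePairs
  where
  solution : ℕ × ℕ
  solution = NegativePell.solution n (1 +ℕ N)
  N+1<u : 1 +ℕ N <ℕ proj₂ solution
  N+1<u = NegativePell.solution-u-grows (>-nonZero⁻¹ n {{n≢0}}) (1 +ℕ N)
  q,n²≡tq² : ∃ λ q → n *ℕ n ≡ t *ℕ (q *ℕ q)
  q,n²≡tq² = n²≡t*q² m∣n t-cases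
  open PellQuadruple t n (proj₁ q,n²≡tq²) {{n≢0}} (proj₂ q,n²≡tq²)
    (proj₁ solution) (proj₂ solution) (NegativePell.solution-isSolution n (1 +ℕ N))
    (ℕ.≤-<-trans (ℕ.m≤m+n 1 N) N+1<u)
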